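{- Let $G$ be a connected graph. Then $i_{dR}(G)\ge i_{\{R2\}}(G)+i(G)$, and this bound is sharp.
   Context: $i(G)$ is the independent domination number: the minimum cardinality of a set that is both independent and dominating in $G$. An independent double Roman dominating function (IDRDF) on $G=(V,E)$ is a function $f:V\to\{0,1,2,3\}$ such that: every vertex $v$ with $f(v)=0$ has at least two neighbors $w$ with $f(w)=2$ or at least one neighbor $w$ with $f(w)=3$; every vertex $v$ with $f(v)=1$ has a neighbor $w$ with $f(w)\ge 2$; and $\{v: f(v)>0\}$ is independent. $i_{dR}(G)$ is the minimum weight $\sum_v f(v)$ of an IDRDF on $G$. A Roman $\{2\}$-dominating function is a function $g:V\to\{0,1,2\}$ such that every $v$ with $g(v)=0$ satisfies $\sum_{u\in N(v)}g(u)\ge 2$; it is independent if $\{v:g(v)>0\}$ is independent. $i_{\{R2\}}(G)$ is the minimum weight of an independent Roman $\{2\}$-dominating function on $G$. -}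

module Defs where

open import Data.Nat using (ℕ; zero; suc; _+_; _≤_)
open import Data.Bool using (Bool; true; false; if_then_else_)
open import Data.Fin using (Fin)
open import Data.Fin.Subset using (Subset; _∈_; _∉_; ∣_∣)
open import Data.Vec using (sum; tabulate)
open import Data.Product using (Σ; ∃; ∃-syntax; _×_; _,_)
open import Data.Sum using (_⊎_)
open import Relation.Nullary using (¬_)
open import Relation.Binary.PropositionalEquality using (_≡_; _≢_)

record Graph : Set where
  field
    n      : ℕ
    adj    : Fin n → Fin n → Bool
    sym    : ∀ u v → adj u v ≡ adj v u
    irrefl : ∀ v → adj v v ≡ false

open Graph public

Adj : (G : Graph) → Fin (n G) → Fin (n G) → Set
Adj G u v = adj G u v ≡ true

data Walk (G : Graph) : Fin (n G) → Fin (n G) → Set where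
  here : ∀ {v} → Walk G v v
  step : ∀ {u v w} → Adj G u v → Walk G v w → Walk G u w

Connected : Graph → Set
Connected G = ∀ u v → Walk G u v

weight : (G : Graph) → (Fin (n G) → ℕ) → ℕ
weight G f = sum (tabulate f)

PosIndependent : (G : Graph) → (Fin (n G) → ℕ) → Set
PosIndependent G f = ∀ u v → Adj G u v → f u ≡ 0 ⊎ f v ≡ 0

IsIDRDF : (G : Graph) → (Fin (n G) → ℕ) → Set
IsIDRDF G f =
  (∀ v → f v ≤ 3)
  × (∀ v → f v ≡ 0 →
       (∃[ w ] (Adj G v w × f w ≡ 3))
       ⊎ (∃[ w₁ ] ∃[ w₂ ] (w₁ ≢ w₂ × Adj G v w₁ × Adj G v w₂ × f w₁ ≡ 2 × f w₂ ≡ 2)))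
  × (∀ v → f v ≡ 1 → ∃[ w ] (Adj G v w × 2 ≤ f w))
  × PosIndependent G f

nbrSum : (G : Graph) → (Fin (n G) → ℕ) → Fin (n G) → ℕ
nbrSum G g v = sum (tabulate (λ u → if adj G v u then g u else 0))

IsIR2DF : (G : Graph) → (Fin (n G) → ℕ) → Set
IsIR2DF G g =
  (∀ v → g v ≤ 2)
  × (∀ v → g v ≡ 0 → 2 ≤ nbrSum G g v)
  × PosIndependent G g

IsIndepDomSet : (G : Graph) → Subset (n G) → Set
IsIndepDomSet G S =
  (∀ u v → u ∈ S → v ∈ S → ¬ Adj G u v)
  × (∀ v → v ∉ S → ∃[ u ] (u ∈ S × Adj G v u))

IsIdR : Graph → ℕ → Set
IsIdR G k = (∃[ f ] (IsIDRDF G f × weight G f ≡ k))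
          × (∀ f → IsIDRDF G f → k ≤ weight G f)

IsIR2 : Graph → ℕ → Set
IsIR2 G k = (∃[ g ] (IsIR2DF G g × weight G g ≡ k))
          × (∀ g → IsIR2DF G g → k ≤ weight G g)

IsI : Graph → ℕ → Set
IsI G k = (∃[ S ] (IsIndepDomSet G S × ∣ S ∣ ≡ k))
        × (∀ S → IsIndepDomSet G S → k ≤ ∣ S ∣)

module Submission where

-- Let f be an IDRDF.  No vertex carries the label 1: its required
-- neighbour with label ≥ 2 would be adjacent to a positive vertex, against
-- independence.  Hence f takes values in {0,2,3}, and f splits as
--     f v = pred (f v) + [f v > 0].
-- The first summand, pred ∘ f, has values in {0,1,2} and is an independent
-- Roman {2}-dominating function (a 3 becomes a 2, two 2s become two 1s); the
-- second is the indicator of the support of f, which is an independent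
-- dominating set.  Summing over the vertices gives
--     w(f) = w(pred ∘ f) + |supp f| ≥ i_{R2}(G) + i(G).  Sharpness is witnessed by
-- the one-vertex graph K₁, where i_dR = 2, i_{R2} = 1 and i = 1; there the
-- lower bound i_dR(K₁) ≥ 2 is again an instance of the general inequality.

open import Defs hiding (sym)
open import Data.Nat using (ℕ; zero; suc; pred; _+_; _≤_; z≤n; s≤s)
open import Data.Nat.Properties
  using (+-0-commutativeMonoid; +-comm; +-mono-≤; +-monoʳ-≤; m≤m+n; ≤-refl; pred-mono-≤; 1+n≢0)
open import Data.Bool using (Bool; true; false; if_then_else_)
open import Data.Fin using (Fin; zero; suc; punchOut)
open import Data.Fin.Properties using (punchIn-punchOut)
open import Data.Fin.Subset using (Subset; _∈_; _∉_; ∣_∣)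
open import Data.Vec using ([]; _∷_; tabulate; lookup)
import Data.Vec as Vec
open import Data.Vec.Properties using ([]=⇒lookup; lookup⇒[]=; lookup∘tabulate)
open import Data.Vec.Functional using (removeAt)
open import Algebra.Properties.CommutativeMonoid.Sum +-0-commutativeMonoid
  using (sum-remove; ∑-distrib-+; sum-cong-≗) renaming (sum to ∑)
open import Data.Product using (∃-syntax; _×_; _,_; proj₂)
open import Data.Sum using (_⊎_; inj₁; inj₂; [_,_]′) renaming (map to ⊎-map)
open import Data.Empty using (⊥-elim)
open import Function using (_∘_)
open import Relation.Nullary using (¬_)
open import Relation.Binary.PropositionalEquality

-- The weights in Defs are sums of tabulated vectors; they agree with the
-- library's functional sum ∑, for which distributivity and term extraction
-- are available.
sum-tabulate : ∀ {m} (h : Fin m → ℕ) → Vec.sum (tabulate h) ≡ ∑ h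
sum-tabulate {zero}  h = refl
sum-tabulate {suc m} h = cong (h zero +_) (sum-tabulate (h ∘ suc))

term≤∑ : ∀ {m} (h : Fin m → ℕ) w → h w ≤ ∑ h
term≤∑ {suc m} h w = subst (h w ≤_) (sym (sum-remove {i = w} h)) (m≤m+n (h w) _)

-- Two distinct terms together are bounded by the whole sum: after removing
-- the term at w₁, the term at w₂ still occurs at position punchOut w₁≢w₂.
pair≤∑ : ∀ {m} (h : Fin m → ℕ) {w₁ w₂} → w₁ ≢ w₂ → h w₁ + h w₂ ≤ ∑ h
pair≤∑ {suc m} h {w₁} {w₂} w₁≢w₂ =
  subst (h w₁ + h w₂ ≤_) (sym (sum-remove {i = w₁} h))
        (+-monoʳ-≤ (h w₁) (subst (_≤ ∑ (removeAt h w₁)) w₂-survives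
                                 (term≤∑ (removeAt h w₁) (punchOut w₁≢w₂))))
  where
  w₂-survives : removeAt h w₁ (punchOut w₁≢w₂) ≡ h w₂
  w₂-survives = cong h (punchIn-punchOut w₁≢w₂)

isPositive : ℕ → Bool
isPositive zero    = false
isPositive (suc _) = true

χ : Bool → ℕ
χ false = 0
χ true  = 1

support : ∀ {m} → (Fin m → ℕ) → Subset m
support f = tabulate (isPositive ∘ f)

∣tabulate∣ : ∀ {m} (p : Fin m → Bool) → ∣ tabulate p ∣ ≡ ∑ (χ ∘ p)
∣tabulate∣ {zero}  p = refl
∣tabulate∣ {suc m} p with p zero
... | true  = cong suc (∣tabulate∣ (p ∘ suc))
... | false = ∣tabulate∣ (p ∘ suc)

pred+χ : ∀ k → pred k + χ (isPositive k) ≡ k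
pred+χ zero    = refl
pred+χ (suc k) = +-comm k 1

∑-split : ∀ {m} (f : Fin m → ℕ) → ∑ (pred ∘ f) + ∣ support f ∣ ≡ ∑ f
∑-split f = begin
  ∑ (pred ∘ f) + ∣ support f ∣                        ≡⟨ cong (∑ (pred ∘ f) +_) (∣tabulate∣ (isPositive ∘ f)) ⟩
  ∑ (pred ∘ f) + ∑ (χ ∘ isPositive ∘ f)              ≡⟨ sym (∑-distrib-+ (pred ∘ f) (χ ∘ isPositive ∘ f)) ⟩
  ∑ (λ v → pred (f v) + χ (isPositive (f v)))         ≡⟨ sum-cong-≗ (pred+χ ∘ f) ⟩
  ∑ f                                                 ∎
  where open ≡-Reasoning

weight-split : ∀ (G : Graph) (f : Fin (n G) → ℕ) →
               weight G (pred ∘ f) + ∣ support f ∣ ≡ weight G f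
weight-split G f =
  trans (cong (_+ ∣ support f ∣) (sum-tabulate (pred ∘ f)))
        (trans (∑-split f) (sym (sum-tabulate f)))

∈-support⁺ : ∀ {m} (f : Fin m → ℕ) {v} → f v ≢ 0 → v ∈ support f
∈-support⁺ f {v} fv≢0 =
  lookup⇒[]= v (support f) (trans (lookup∘tabulate (isPositive ∘ f) v) (positive (f v) fv≢0))
  where
  positive : ∀ k → k ≢ 0 → isPositive k ≡ true
  positive zero    k≢0 = ⊥-elim (k≢0 refl)
  positive (suc k) _   = refl

∈-support⁻ : ∀ {m} (f : Fin m → ℕ) {v} → v ∈ support f → f v ≢ 0
∈-support⁻ f {v} v∈ fv≡0 = false≢true (begin
  false                        ≡⟨ cong isPositive fv≡0 ⟨
  isPositive (f v)             ≡⟨ lookup∘tabulate (isPositive ∘ f) v ⟨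
  lookup (support f) v         ≡⟨ []=⇒lookup v∈ ⟩
  true                         ∎)
  where
  open ≡-Reasoning
  false≢true : false ≢ true
  false≢true ()

∉-support : ∀ {m} (f : Fin m → ℕ) {v} → v ∉ support f → f v ≡ 0
∉-support f {v} v∉ with f v in fv≡
... | zero  = refl
... | suc _ = ⊥-elim (v∉ (∈-support⁺ f (λ fv≡0 → 1+n≢0 (trans (sym fv≡) fv≡0))))

nbrTerm : (G : Graph) → (Fin (n G) → ℕ) → Fin (n G) → Fin (n G) → ℕ
nbrTerm G g v u = if adj G v u then g u else 0

nbrTerm-adj : ∀ (G : Graph) (g : Fin (n G) → ℕ) {v w} → Adj G v w → nbrTerm G g v w ≡ g w
nbrTerm-adj G g v~w rewrite v~w = refl

nbrSum-∑ : ∀ (G : Graph) (g : Fin (n G) → ℕ) v → ∑ (nbrTerm G g v) ≡ nbrSum G g v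
nbrSum-∑ G g v = sym (sum-tabulate (nbrTerm G g v))

nbrSum-≥-one : ∀ (G : Graph) (g : Fin (n G) → ℕ) {v w} → Adj G v w →
               g w ≤ nbrSum G g v
nbrSum-≥-one G g {v} {w} v~w =
  subst₂ _≤_ (nbrTerm-adj G g v~w) (nbrSum-∑ G g v) (term≤∑ (nbrTerm G g v) w)

nbrSum-≥-two : ∀ (G : Graph) (g : Fin (n G) → ℕ) {v w₁ w₂} → w₁ ≢ w₂ →
               Adj G v w₁ → Adj G v w₂ → g w₁ + g w₂ ≤ nbrSum G g v
nbrSum-≥-two G g {v} w₁≢w₂ v~w₁ v~w₂ =
  subst₂ _≤_ (cong₂ _+_ (nbrTerm-adj G g v~w₁) (nbrTerm-adj G g v~w₂)) (nbrSum-∑ G g v)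
         (pair≤∑ (nbrTerm G g v) w₁≢w₂)

DoubleRomanDominated : (G : Graph) → (Fin (n G) → ℕ) → Fin (n G) → Set
DoubleRomanDominated G f v =
  (∃[ w ] (Adj G v w × f w ≡ 3))
  ⊎ (∃[ w₁ ] ∃[ w₂ ] (w₁ ≢ w₂ × Adj G v w₁ × Adj G v w₂ × f w₁ ≡ 2 × f w₂ ≡ 2))

-- An IDRDF never uses the label 1: the neighbour of label ≥ 2 that a
-- 1-vertex needs would violate independence of the positive vertices.
IDRDF-no-one : ∀ (G : Graph) (f : Fin (n G) → ℕ) → IsIDRDF G f → ∀ v → f v ≢ 1
IDRDF-no-one G f (_ , _ , one-cond , indep) v fv≡1 with one-cond v fv≡1
... | w , v~w , 2≤fw with indep v w v~w
...   | inj₁ fv≡0 = 1+n≢0 (trans (sym fv≡1) fv≡0)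
...   | inj₂ fw≡0 = 2≰0 (subst (2 ≤_) fw≡0 2≤fw)
  where
  2≰0 : ¬ (2 ≤ 0)
  2≰0 ()

-- Lowering every label by one keeps the double Roman domination as Roman
-- {2}-domination: a 3 becomes 2, two 2s become two 1s.
pred-dominates : ∀ (G : Graph) (f : Fin (n G) → ℕ) v →
                 DoubleRomanDominated G f v → 2 ≤ nbrSum G (pred ∘ f) v
pred-dominates G f v (inj₁ (w , v~w , fw≡3)) =
  subst (_≤ nbrSum G (pred ∘ f) v) (cong pred fw≡3) (nbrSum-≥-one G (pred ∘ f) v~w)
pred-dominates G f v (inj₂ (w₁ , w₂ , w₁≢w₂ , v~w₁ , v~w₂ , fw₁≡2 , fw₂≡2)) =
  subst (_≤ nbrSum G (pred ∘ f) v) (cong₂ (λ a b → pred a + pred b) fw₁≡2 fw₂≡2)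
        (nbrSum-≥-two G (pred ∘ f) w₁≢w₂ v~w₁ v~w₂)

-- If f is an IDRDF then pred ∘ f is an independent Roman {2}-dominating
-- function; a vertex with pred (f v) = 0 has f v = 0 because f v ≠ 1.
IDRDF⇒IR2DF : ∀ (G : Graph) (f : Fin (n G) → ℕ) → IsIDRDF G f → IsIR2DF G (pred ∘ f)
IDRDF⇒IR2DF G f isIDRDF@(f≤3 , zero-cond , _ , indep) =
  (λ v → pred-mono-≤ (f≤3 v)) ,
  (λ v pfv≡0 → pred-dominates G f v (zero-cond v (pred≡0 v pfv≡0))) ,
  (λ u v u~v → ⊎-map (cong pred) (cong pred) (indep u v u~v))
  where
  pred≡0 : ∀ v → pred (f v) ≡ 0 → f v ≡ 0
  pred≡0 v pfv≡0 with f v | IDRDF-no-one G f isIDRDF v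
  ... | zero        | _    = refl
  ... | suc zero    | fv≢1 = ⊥-elim (fv≢1 refl)
  ... | suc (suc _) | _    = ⊥-elim (1+n≢0 pfv≡0)

support-indepDom : ∀ (G : Graph) (f : Fin (n G) → ℕ) → PosIndependent G f →
                   (∀ v → f v ≡ 0 → ∃[ w ] (Adj G v w × f w ≢ 0)) →
                   IsIndepDomSet G (support f)
support-indepDom G f indep positive-nbr =
  (λ u v u∈ v∈ u~v → [ ∈-support⁻ f u∈ , ∈-support⁻ f v∈ ]′ (indep u v u~v)) ,
  (λ v v∉ → let (w , v~w , fw≢0) = positive-nbr v (∉-support f v∉)
            in w , ∈-support⁺ f fw≢0 , v~w)

IDRDF⇒IndepDomSet : ∀ (G : Graph) (f : Fin (n G) → ℕ) → IsIDRDF G f →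
                    IsIndepDomSet G (support f)
IDRDF⇒IndepDomSet G f (_ , zero-cond , _ , indep) =
  support-indepDom G f indep (λ v fv≡0 → positive-nbr (zero-cond v fv≡0))
  where
  positive-nbr : ∀ {v} → DoubleRomanDominated G f v → ∃[ w ] (Adj G v w × f w ≢ 0)
  positive-nbr (inj₁ (w , v~w , fw≡3)) = w , v~w , 1+n≢0 ∘ trans (sym fw≡3)
  positive-nbr (inj₂ (w₁ , _ , _ , v~w₁ , _ , fw₁≡2 , _)) = w₁ , v~w₁ , 1+n≢0 ∘ trans (sym fw₁≡2)

IDRDF-weight-≥ : ∀ (G : Graph) {b c} →
                 (∀ g → IsIR2DF G g → b ≤ weight G g) →
                 (∀ S → IsIndepDomSet G S → c ≤ ∣ S ∣) →
                 ∀ f → IsIDRDF G f → b + c ≤ weight G f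
IDRDF-weight-≥ G b≤ c≤ f isIDRDF =
  subst (_ ≤_) (weight-split G f)
        (+-mono-≤ (b≤ (pred ∘ f) (IDRDF⇒IR2DF G f isIDRDF))
                  (c≤ (support f) (IDRDF⇒IndepDomSet G f isIDRDF)))

idR≥iR2+i : ∀ (G : Graph) a b c → IsIdR G a → IsIR2 G b → IsI G c → b + c ≤ a
idR≥iR2+i G a b c ((f , isIDRDF , wf≡a) , _) (_ , b-min) (_ , c-min) =
  subst (_ ≤_) wf≡a (IDRDF-weight-≥ G b-min c-min f isIDRDF)

K₁ : Graph
K₁ = record { n = 1 ; adj = λ _ _ → false ; sym = λ _ _ → refl ; irrefl = λ _ → refl }

K₁-connected : Connected K₁
K₁-connected zero zero = here

-- i_{R2}(K₁) = 1: the lone vertex has no neighbours, so it cannot be labelled 0.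
K₁-iR2 : IsIR2 K₁ 1
K₁-iR2 = ((λ _ → 1) , ((λ _ → s≤s z≤n) , (λ _ ()) , (λ _ _ ())) , refl) , minimal
  where
  minimal : ∀ g → IsIR2DF K₁ g → 1 ≤ weight K₁ g
  minimal g (_ , zero-cond , _) with g zero in g0≡
  ... | zero  with zero-cond zero g0≡
  ...   | ()
  minimal g _ | suc _ = s≤s z≤n

-- i(K₁) = 1: the empty set does not dominate the lone vertex.
K₁-i : IsI K₁ 1
K₁-i = ((true ∷ []) , ((λ _ _ _ _ ()) , (λ { zero 0∉ → ⊥-elim (0∉ Data.Vec.here) })) , refl) , minimal
  where
  minimal : ∀ S → IsIndepDomSet K₁ S → 1 ≤ ∣ S ∣
  minimal (true  ∷ []) _              = ≤-refl
  minimal (false ∷ []) (_ , dominate) with dominate zero (λ ())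
  ... | _ , _ , ()

-- i_dR(K₁) = 2: the constant labelling 2 is an IDRDF, and by the general
-- inequality every IDRDF weighs at least i_{R2}(K₁) + i(K₁) = 2.
K₁-idR : IsIdR K₁ 2
K₁-idR = ((λ _ → 2) , ((λ _ → s≤s (s≤s z≤n)) , (λ _ ()) , (λ _ ()) , (λ _ _ ())) , refl) ,
         IDRDF-weight-≥ K₁ (proj₂ K₁-iR2) (proj₂ K₁-i)


theorem8 : (∀ (G : Graph) → Connected G → ∀ a b c →
    IsIdR G a → IsIR2 G b → IsI G c → b + c ≤ a)
    × (∃[ G ] ∃[ a ] ∃[ b ] ∃[ c ]
    (Connected G × IsIdR G a × IsIR2 G b × IsI G c × a ≡ b + c))
theorem8 = (λ G _ → idR≥iR2+i G) ,
           (K₁ , 2 , 1 , 1 , K₁-connected , K₁-idR , K₁-iR2 , K₁-i , refl)
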